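{- For integers $r\ge 3$ and $1 \leq n_1 \leq n_2$, \[ \operatorname{ex}(K_{n_1,n_2,\ldots,n_2}, K_r) = (r-1)n_1n_2+\binom{r-1}{2}n_2^2 - n_1n_2, \] where $K_{n_1,n_2,\ldots,n_2}$ is the complete $r$-partite graph with one part of size $n_1$ and $r-1$ parts of size $n_2$.
   Context: All graphs are finite, undirected and simple. A complete $r$-partite graph $K_{n_1,\ldots,n_r}$ has vertex set partitioned into independent sets $V_1,\dots,V_r$ with $|V_i|=n_i$, and every pair of vertices in distinct parts is adjacent. $K_r$ is the complete graph on $r$ vertices. For graphs $G,H$, $\operatorname{ex}(G,H)$ is the maximum number of edges in a subgraph of $G$ containing no copy of $H$. The right-hand side equals $\sum_{1\le i<j\le r} n_in_j - n_1n_2$ for part sizes $(n_1,n_2,\ldots,n_2)$. -}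

module Defs where

open import Data.Nat using (ℕ; zero; suc; _+_; _*_; _<_; _≤_)
open import Data.Fin using (Fin; zero; suc)
open import Data.Bool using (Bool; true; false)
open import Data.List using (List; []; _∷_; map; concatMap; length; filter; allFin; _++_)
open import Data.Product using (Σ; Σ-syntax; _×_; _,_; proj₁; proj₂)
open import Relation.Binary.PropositionalEquality using (_≡_; _≢_)
open import Relation.Nullary using (¬_)
open import Data.Bool using (T)
open import Function.Definitions using (Injective)

Vertex : (r : ℕ) → (Fin r → ℕ) → Set
Vertex r sizes = Σ (Fin r) (λ i → Fin (sizes i))

part : ∀ {r sizes} → Vertex r sizes → Fin r
part = proj₁

vertices : (r : ℕ) (sizes : Fin r → ℕ) → List (Vertex r sizes)
vertices r sizes = concatMap (λ i → map (λ x → (i , x)) (allFin (sizes i))) (allFin r)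

-- all unordered pairs {u , v} of a list, each listed once as (earlier , later)
pairs : ∀ {A : Set} → List A → List (A × A)
pairs []       = []
pairs (x ∷ xs) = map (λ y → (x , y)) xs ++ pairs xs

record Subgraph (r : ℕ) (sizes : Fin r → ℕ) : Set where
  field
    adj       : Vertex r sizes → Vertex r sizes → Bool
    symmetric : ∀ u v → adj u v ≡ adj v u
    inHost    : ∀ u v → adj u v ≡ true → part u ≢ part v
open Subgraph public

edgeCount : ∀ {r sizes} → Subgraph r sizes → ℕ
edgeCount {r} {sizes} G =
  length (filter (λ p → Data.Bool._≟_ (adj G (proj₁ p) (proj₂ p)) true) (pairs (vertices r sizes)))
  where import Data.Bool

ContainsK : ∀ {r sizes} → ℕ → Subgraph r sizes → Set
ContainsK {r} {sizes} k G =
  Σ (Fin k → Vertex r sizes) λ f →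
    Injective _≡_ _≡_ f × (∀ i j → i ≢ j → adj G (f i) (f j) ≡ true)

KFree : ∀ {r sizes} → ℕ → Subgraph r sizes → Set
KFree k G = ¬ ContainsK k G

ExIs : (r : ℕ) (sizes : Fin r → ℕ) (k : ℕ) (m : ℕ) → Set
ExIs r sizes k m =
  (Σ (Subgraph r sizes) λ G → KFree k G × edgeCount G ≡ m)
  × (∀ (G : Subgraph r sizes) → KFree k G → edgeCount G ≤ m)

sizes₁₂ : ∀ {r} → ℕ → ℕ → Fin r → ℕ
sizes₁₂ n₁ n₂ zero    = n₁
sizes₁₂ n₁ n₂ (suc _) = n₂

module Submission where

-- Every subgraph G of the host K_s splits the host edges into edges and
-- non-edges of G, so it suffices to show that a K_r-free G has at least
-- n₁n₂ non-edges, and that some K_r-free G has exactly n₁n₂ of them.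
--
-- Lower bound (averaging over transversals).  A transversal picks one vertex
-- in each of the r parts; since G is K_r-free, every transversal spans a
-- non-edge of G.  A non-edge between parts i ≠ j lies in exactly
-- N / (sᵢsⱼ) of the N transversals, and sᵢsⱼ ≥ c for all i ≠ j, so counting
-- the pairs (transversal, non-edge inside it) gives  c·N ≤ N·#non-edges.
--
-- Delete all edges between the first two parts: any r vertices
-- then have two in the same part or one in each of the first two parts, so
-- the graph is K_r-free, with exactly s₀s₁ non-edges.

open import Defs
open import Data.Nat using (ℕ; zero; suc; _+_; _*_; _∸_; _≤_; z≤n; s≤s; NonZero; >-nonZero)
open import Data.Nat.Properties hiding (_≟_; <⇒≢)
open import Data.Nat.Tactic.RingSolver using (solve-∀)
open import Data.Nat.Combinatorics using (_C_; nC1≡n; nCk+nC[k+1]≡[n+1]C[k+1])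
open import Data.Fin using (Fin; zero; suc)
open import Data.Fin.Properties using (_≟_; pigeonhole; <⇒≢)
open import Data.Bool using (Bool; true; false; not; T) renaming (_≟_ to _≟ᵇ_)
open import Data.List using (List; []; _∷_; map; concatMap; length; filter; allFin; _++_)
open import Data.List.Properties using (length-tabulate; map-tabulate)
open import Data.List.Membership.Propositional using (_∈_)
open import Data.List.Membership.Propositional.Properties using (∈-map⁺; ∈-++⁺ˡ; ∈-++⁺ʳ; ∈-allFin)
open import Data.List.Relation.Unary.Any using (here; there)
open import Data.Product using (_,_; proj₁; proj₂)
open import Data.Sum using (_⊎_; inj₁; inj₂)
open import Relation.Binary.PropositionalEquality
open import Relation.Nullary using (Dec; does; yes; no)
open import Relation.Nullary.Decidable using (dec-true; dec-false)
open import Data.Empty using (⊥-elim)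
open import Data.Unit using (tt)
open import Function using (_∘_; id; flip)

private variable A B : Set

-- Finite sums over lists

∑ : List A → (A → ℕ) → ℕ
∑ []       f = 0
∑ (x ∷ xs) f = f x + ∑ xs f

∑-++ : ∀ (xs ys : List A) f → ∑ (xs ++ ys) f ≡ ∑ xs f + ∑ ys f
∑-++ []       ys f = refl
∑-++ (x ∷ xs) ys f = trans (cong (f x +_) (∑-++ xs ys f)) (sym (+-assoc (f x) _ _))

∑-map : ∀ (g : A → B) xs f → ∑ (map g xs) f ≡ ∑ xs (f ∘ g)
∑-map g []       f = refl
∑-map g (x ∷ xs) f = cong (f (g x) +_) (∑-map g xs f)

∑-cong : ∀ (xs : List A) {f g} → (∀ x → f x ≡ g x) → ∑ xs f ≡ ∑ xs g
∑-cong []       eq = refl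
∑-cong (x ∷ xs) eq = cong₂ _+_ (eq x) (∑-cong xs eq)

∑-mono : ∀ (xs : List A) {f g} → (∀ x → f x ≤ g x) → ∑ xs f ≤ ∑ xs g
∑-mono []       le = z≤n
∑-mono (x ∷ xs) le = +-mono-≤ (le x) (∑-mono xs le)

∑-+ : ∀ (xs : List A) f g → ∑ xs (λ x → f x + g x) ≡ ∑ xs f + ∑ xs g
∑-+ []       f g = refl
∑-+ (x ∷ xs) f g rewrite ∑-+ xs f g = interchange (f x) (g x) (∑ xs f) (∑ xs g)
  where
  interchange : ∀ a b c d → a + b + (c + d) ≡ a + c + (b + d)
  interchange = solve-∀

∑-*ˡ : ∀ (xs : List A) c f → ∑ xs (λ x → c * f x) ≡ c * ∑ xs f
∑-*ˡ []       c f = sym (*-zeroʳ c)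
∑-*ˡ (x ∷ xs) c f rewrite ∑-*ˡ xs c f = sym (*-distribˡ-+ c (f x) (∑ xs f))

∑-*ʳ : ∀ (xs : List A) c f → ∑ xs (λ x → f x * c) ≡ ∑ xs f * c
∑-*ʳ []       c f = refl
∑-*ʳ (x ∷ xs) c f rewrite ∑-*ʳ xs c f = sym (*-distribʳ-+ c (f x) (∑ xs f))

∑-zero : ∀ (xs : List A) {f} → (∀ x → f x ≡ 0) → ∑ xs f ≡ 0
∑-zero []       eq = refl
∑-zero (x ∷ xs) eq rewrite eq x = ∑-zero xs eq

∑-const : ∀ (xs : List A) c → ∑ xs (λ _ → c) ≡ length xs * c
∑-const []       c = refl
∑-const (x ∷ xs) c = cong (c +_) (∑-const xs c)

∑-allFin-const : ∀ n c → ∑ (allFin n) (λ _ → c) ≡ n * c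
∑-allFin-const n c = trans (∑-const (allFin n) c) (cong (_* c) (length-tabulate {n = n} id))

∑-swap : ∀ (xs : List A) (ys : List B) (f : A → B → ℕ) →
  ∑ xs (λ x → ∑ ys (f x)) ≡ ∑ ys (λ y → ∑ xs (λ x → f x y))
∑-swap []       ys f = sym (∑-zero ys (λ _ → refl))
∑-swap (x ∷ xs) ys f =
  trans (cong (∑ ys (f x) +_) (∑-swap xs ys f))
        (sym (∑-+ ys (f x) (λ y → ∑ xs (λ x' → f x' y))))

∑-concatMap : ∀ (B' : A → List B) I (f : B → ℕ) →
  ∑ (concatMap B' I) f ≡ ∑ I (λ i → ∑ (B' i) f)
∑-concatMap B' []      f = refl
∑-concatMap B' (i ∷ I) f =
  trans (∑-++ (B' i) (concatMap B' I) f) (cong (∑ (B' i) f +_) (∑-concatMap B' I f))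

∑≡0⇒term≡0 : ∀ (xs : List A) f {x} → ∑ xs f ≡ 0 → x ∈ xs → f x ≡ 0
∑≡0⇒term≡0 (y ∷ xs) f sum≡0 (here refl) = m+n≡0⇒m≡0 (f y) sum≡0
∑≡0⇒term≡0 (y ∷ xs) f sum≡0 (there x∈xs) =
  ∑≡0⇒term≡0 xs f (m+n≡0⇒n≡0 (f y) sum≡0) x∈xs

allFin-suc : ∀ k → allFin (suc k) ≡ zero ∷ map suc (allFin k)
allFin-suc k = cong (zero ∷_) (sym (map-tabulate id suc))

∑pairs : List A → (A → A → ℕ) → ℕ
∑pairs L f = ∑ (pairs L) (λ p → f (proj₁ p) (proj₂ p))

∑pairs-cons : ∀ x (xs : List A) f → ∑pairs (x ∷ xs) f ≡ ∑ xs (f x) + ∑pairs xs f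
∑pairs-cons x xs f = trans (∑-++ (map (λ y → (x , y)) xs) (pairs xs) _)
                           (cong (_+ ∑pairs xs f) (∑-map _ xs _))

∑pairs-map : ∀ (g : A → B) xs f → ∑pairs (map g xs) f ≡ ∑pairs xs (λ a b → f (g a) (g b))
∑pairs-map g []       f = refl
∑pairs-map g (x ∷ xs) f =
  trans (∑pairs-cons (g x) (map g xs) f)
  (trans (cong₂ _+_ (∑-map g xs (f (g x))) (∑pairs-map g xs f))
         (sym (∑pairs-cons x xs _)))

∑pairs-++ : ∀ (xs ys : List A) f →
  ∑pairs (xs ++ ys) f ≡ ∑pairs xs f + ∑pairs ys f + ∑ xs (λ x → ∑ ys (f x))
∑pairs-++ []       ys f = sym (+-identityʳ _)
∑pairs-++ (x ∷ xs) ys f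
  rewrite ∑pairs-cons x (xs ++ ys) f | ∑pairs-cons x xs f | ∑-++ xs ys (f x) | ∑pairs-++ xs ys f
  = regroup (∑ xs (f x)) (∑ ys (f x)) (∑pairs xs f) (∑pairs ys f) (∑ xs (λ x₁ → ∑ ys (f x₁)))
  where
  regroup : ∀ a b c d e → a + b + (c + d + e) ≡ a + c + d + (b + e)
  regroup = solve-∀

∑pairs-cong : ∀ (xs : List A) {f g} → (∀ a b → f a b ≡ g a b) → ∑pairs xs f ≡ ∑pairs xs g
∑pairs-cong xs eq = ∑-cong (pairs xs) (λ p → eq (proj₁ p) (proj₂ p))

∑pairs-concatMap : ∀ {A B : Set} (B' : A → List B) I f →
  ∑pairs (concatMap B' I) f
    ≡ ∑ I (λ i → ∑pairs (B' i) f) + ∑pairs I (λ i j → ∑ (B' i) (λ x → ∑ (B' j) (f x)))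
∑pairs-concatMap B' []      f = refl
∑pairs-concatMap {A} B' (i ∷ I) f = begin
  ∑pairs (B' i ++ concatMap B' I) f
    ≡⟨ ∑pairs-++ (B' i) (concatMap B' I) f ⟩
  inner + ∑pairs (concatMap B' I) f + ∑ (B' i) (λ x → ∑ (concatMap B' I) (f x))
    ≡⟨ cong₂ (λ u v → inner + u + v) (∑pairs-concatMap B' I f) acrossFirst ⟩
  inner + (insides + across) + ∑ I (cross i)
    ≡⟨ regroup inner insides across (∑ I (cross i)) ⟩
  inner + insides + (∑ I (cross i) + across)
    ≡⟨ cong (inner + insides +_) (sym (∑pairs-cons i I cross)) ⟩
  inner + insides + ∑pairs (i ∷ I) cross ∎
  where
  open ≡-Reasoning
  cross : A → A → ℕ
  cross i j = ∑ (B' i) (λ x → ∑ (B' j) (f x))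
  inner insides across : ℕ
  inner = ∑pairs (B' i) f
  insides = ∑ I (λ i → ∑pairs (B' i) f)
  across = ∑pairs I cross
  acrossFirst : ∑ (B' i) (λ x → ∑ (concatMap B' I) (f x)) ≡ ∑ I (cross i)
  acrossFirst = trans (∑-cong (B' i) (λ x → ∑-concatMap B' I (f x)))
                      (∑-swap (B' i) I (λ x j → ∑ (B' j) (f x)))
  regroup : ∀ a b c d → a + (b + c) + d ≡ a + b + (d + c)
  regroup = solve-∀

∑pairs-allFin-suc : ∀ k (F : Fin (suc k) → Fin (suc k) → ℕ) →
  ∑pairs (allFin (suc k)) F
    ≡ ∑ (allFin k) (λ j → F zero (suc j)) + ∑pairs (allFin k) (λ i j → F (suc i) (suc j))
∑pairs-allFin-suc k F =
  trans (cong (λ L → ∑pairs L F) (allFin-suc k))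
  (trans (∑pairs-cons zero (map suc (allFin k)) F)
         (cong₂ _+_ (∑-map suc (allFin k) (F zero)) (∑pairs-map suc (allFin k) F)))

pairs-complete : ∀ (L : List A) {x y} → x ∈ L → y ∈ L → x ≢ y →
  (x , y) ∈ pairs L ⊎ (y , x) ∈ pairs L
pairs-complete (z ∷ zs) (here refl) (here refl) x≢y = ⊥-elim (x≢y refl)
pairs-complete (z ∷ zs) (here refl) (there y∈) _ = inj₁ (∈-++⁺ˡ (∈-map⁺ (z ,_) y∈))
pairs-complete (z ∷ zs) (there x∈) (here refl) _ = inj₂ (∈-++⁺ˡ (∈-map⁺ (z ,_) x∈))
pairs-complete (z ∷ zs) (there x∈) (there y∈) x≢y with pairs-complete zs x∈ y∈ x≢y
... | inj₁ p = inj₁ (∈-++⁺ʳ (map (z ,_) zs) p)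
... | inj₂ p = inj₂ (∈-++⁺ʳ (map (z ,_) zs) p)

-- Transversals of a family of parts

Transversal : (r : ℕ) → (Fin r → ℕ) → Set
Transversal r s = (i : Fin r) → Fin (s i)

_◂_ : ∀ {r} {s : Fin (suc r) → ℕ} → Fin (s zero) → Transversal r (s ∘ suc) → Transversal (suc r) s
(a ◂ t) zero    = a
(a ◂ t) (suc i) = t i

transversals : (r : ℕ) (s : Fin r → ℕ) → List (Transversal r s)
transversals zero    s = (λ ()) ∷ []
transversals (suc r) s = concatMap (λ a → map (a ◂_) (transversals r (s ∘ suc))) (allFin (s zero))

#transversals : (r : ℕ) → (Fin r → ℕ) → ℕ
#transversals zero    s = 1
#transversals (suc r) s = s zero * #transversals r (s ∘ suc)

#transversals-pos : ∀ r (s : Fin r → ℕ) → (∀ i → 1 ≤ s i) → 1 ≤ #transversals r s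
#transversals-pos zero    s pos = s≤s z≤n
#transversals-pos (suc r) s pos = *-mono-≤ (pos zero) (#transversals-pos r (s ∘ suc) (pos ∘ suc))

∑T-suc : ∀ r (s : Fin (suc r) → ℕ) F →
  ∑ (transversals (suc r) s) F ≡ ∑ (allFin (s zero)) (λ a → ∑ (transversals r (s ∘ suc)) (F ∘ (a ◂_)))
∑T-suc r s F =
  trans (∑-concatMap (λ a → map (a ◂_) (transversals r (s ∘ suc))) (allFin (s zero)) F)
        (∑-cong (allFin (s zero)) (λ a → ∑-map (a ◂_) (transversals r (s ∘ suc)) F))

∑T-const : ∀ r s c → ∑ (transversals r s) (λ _ → c) ≡ #transversals r s * c
∑T-const zero    s c = trans (+-identityʳ c) (sym (+-identityʳ c))
∑T-const (suc r) s c =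
  trans (∑T-suc r s (λ _ → c))
  (trans (∑-cong (allFin (s zero)) (λ a → ∑T-const r (s ∘ suc) c))
  (trans (∑-allFin-const (s zero) _) (sym (*-assoc (s zero) _ c))))

-- Each position a of part i lies on N / sᵢ transversals (N = #transversals):
-- summing h over the i-th choice of all transversals counts ∑ h that often.
∑T-coordinate : ∀ r s (i : Fin r) (h : Fin (s i) → ℕ) →
  ∑ (transversals r s) (λ t → h (t i)) * s i ≡ #transversals r s * ∑ (allFin (s i)) h
∑T-coordinate (suc r) s zero h = begin
  ∑ (transversals (suc r) s) (λ t → h (t zero)) * s zero
    ≡⟨ cong (_* s zero) (∑T-suc r s (λ t → h (t zero))) ⟩
  ∑ (allFin (s zero)) (λ a → ∑ (transversals r (s ∘ suc)) (λ _ → h a)) * s zero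
    ≡⟨ cong (_* s zero) (∑-cong (allFin (s zero)) (λ a → ∑T-const r (s ∘ suc) (h a))) ⟩
  ∑ (allFin (s zero)) (λ a → N' * h a) * s zero
    ≡⟨ cong (_* s zero) (∑-*ˡ (allFin (s zero)) N' h) ⟩
  N' * H * s zero
    ≡⟨ rearrange N' H (s zero) ⟩
  s zero * N' * H ∎
  where
  open ≡-Reasoning
  N' H : ℕ
  N' = #transversals r (s ∘ suc)
  H = ∑ (allFin (s zero)) h
  rearrange : ∀ a b c → a * b * c ≡ c * a * b
  rearrange = solve-∀
∑T-coordinate (suc r) s (suc i) h = begin
  ∑ (transversals (suc r) s) (λ t → h (t (suc i))) * s (suc i)
    ≡⟨ cong (_* s (suc i)) (trans (∑T-suc r s (λ t → h (t (suc i)))) (∑-allFin-const (s zero) X)) ⟩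
  s zero * X * s (suc i)
    ≡⟨ *-assoc (s zero) X (s (suc i)) ⟩
  s zero * (X * s (suc i))
    ≡⟨ cong (s zero *_) (∑T-coordinate r (s ∘ suc) i h) ⟩
  s zero * (#transversals r (s ∘ suc) * ∑ (allFin (s (suc i))) h)
    ≡⟨ sym (*-assoc (s zero) _ _) ⟩
  #transversals (suc r) s * ∑ (allFin (s (suc i))) h ∎
  where
  open ≡-Reasoning
  X : ℕ
  X = ∑ (transversals r (s ∘ suc)) (λ t → h (t i))

-- Each pair of positions (a , b) in distinct parts i ≠ j lies on N / (sᵢsⱼ)
-- transversals.
∑T-coordinates : ∀ r s (i j : Fin r) → i ≢ j → (g : Fin (s i) → Fin (s j) → ℕ) →
  ∑ (transversals r s) (λ t → g (t i) (t j)) * (s i * s j)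
    ≡ #transversals r s * ∑ (allFin (s i)) (λ a → ∑ (allFin (s j)) (g a))
∑T-coordinates (suc r) s zero zero i≢j g = ⊥-elim (i≢j refl)
∑T-coordinates (suc r) s zero (suc j) _ g = begin
  ∑ (transversals (suc r) s) (λ t → g (t zero) (t (suc j))) * (s zero * s (suc j))
    ≡⟨ cong (_* (s zero * s (suc j))) (∑T-suc r s (λ t → g (t zero) (t (suc j)))) ⟩
  ∑ (allFin (s zero)) Y * (s zero * s (suc j))
    ≡⟨ sym (∑-*ʳ (allFin (s zero)) _ Y) ⟩
  ∑ (allFin (s zero)) (λ a → Y a * (s zero * s (suc j)))
    ≡⟨ ∑-cong (allFin (s zero)) (λ a → trans (rearrange (Y a) (s zero) (s (suc j)))
                                       (cong (s zero *_) (∑T-coordinate r (s ∘ suc) j (g a)))) ⟩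
  ∑ (allFin (s zero)) (λ a → s zero * (N' * G a))
    ≡⟨ ∑-*ˡ (allFin (s zero)) (s zero) (λ a → N' * G a) ⟩
  s zero * ∑ (allFin (s zero)) (λ a → N' * G a)
    ≡⟨ cong (s zero *_) (∑-*ˡ (allFin (s zero)) N' G) ⟩
  s zero * (N' * ∑ (allFin (s zero)) G)
    ≡⟨ sym (*-assoc (s zero) N' _) ⟩
  #transversals (suc r) s * ∑ (allFin (s zero)) G ∎
  where
  open ≡-Reasoning
  N' : ℕ
  N' = #transversals r (s ∘ suc)
  Y G : Fin (s zero) → ℕ
  Y a = ∑ (transversals r (s ∘ suc)) (λ t → g a (t j))
  G a = ∑ (allFin (s (suc j))) (g a)
  rearrange : ∀ a b c → a * (b * c) ≡ b * (a * c)
  rearrange = solve-∀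
∑T-coordinates (suc r) s (suc i) zero _ g = begin
  ∑ (transversals (suc r) s) (λ t → g (t (suc i)) (t zero)) * (s (suc i) * s zero)
    ≡⟨ cong (∑ (transversals (suc r) s) (λ t → g (t (suc i)) (t zero)) *_) (*-comm (s (suc i)) (s zero)) ⟩
  ∑ (transversals (suc r) s) (λ t → flip g (t zero) (t (suc i))) * (s zero * s (suc i))
    ≡⟨ ∑T-coordinates (suc r) s zero (suc i) (λ ()) (flip g) ⟩
  #transversals (suc r) s * ∑ (allFin (s zero)) (λ b → ∑ (allFin (s (suc i))) (flip g b))
    ≡⟨ cong (#transversals (suc r) s *_) (∑-swap (allFin (s zero)) (allFin (s (suc i))) (flip g)) ⟩
  #transversals (suc r) s * ∑ (allFin (s (suc i))) (λ a → ∑ (allFin (s zero)) (g a)) ∎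
  where open ≡-Reasoning
∑T-coordinates (suc r) s (suc i) (suc j) i≢j g = begin
  ∑ (transversals (suc r) s) (λ t → g (t (suc i)) (t (suc j))) * (s (suc i) * s (suc j))
    ≡⟨ cong (_* (s (suc i) * s (suc j)))
            (trans (∑T-suc r s (λ t → g (t (suc i)) (t (suc j)))) (∑-allFin-const (s zero) X)) ⟩
  s zero * X * (s (suc i) * s (suc j))
    ≡⟨ *-assoc (s zero) X _ ⟩
  s zero * (X * (s (suc i) * s (suc j)))
    ≡⟨ cong (s zero *_) (∑T-coordinates r (s ∘ suc) i j (i≢j ∘ cong suc) g) ⟩
  s zero * (#transversals r (s ∘ suc) * ∑ (allFin (s (suc i))) (λ a → ∑ (allFin (s (suc j))) (g a)))
    ≡⟨ sym (*-assoc (s zero) _ _) ⟩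
  #transversals (suc r) s * ∑ (allFin (s (suc i))) (λ a → ∑ (allFin (s (suc j))) (g a)) ∎
  where
  open ≡-Reasoning
  X : ℕ
  X = ∑ (transversals r (s ∘ suc)) (λ t → g (t i) (t j))

ind : Bool → ℕ
ind true  = 1
ind false = 0

-- nonEdgeInd adjacent sameParts is 1 exactly for a pair of vertices in
-- distinct parts (a host edge) that is not adjacent.
nonEdgeInd : Bool → Bool → ℕ
nonEdgeInd true  _     = 0
nonEdgeInd false true  = 0
nonEdgeInd false false = 1

nonEdgeInd-samePart : ∀ b → nonEdgeInd b true ≡ 0
nonEdgeInd-samePart true  = refl
nonEdgeInd-samePart false = refl

nonEdgeInd≡0⇒adjacent : ∀ b → nonEdgeInd b false ≡ 0 → b ≡ true
nonEdgeInd≡0⇒adjacent true  _ = refl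

module _ {r : ℕ} {s : Fin r → ℕ} where

  samePart : Vertex r s → Vertex r s → Bool
  samePart u v = does (part u ≟ part v)

  hostEdge : Vertex r s → Vertex r s → ℕ
  hostEdge u v = ind (not (samePart u v))

  isEdge : Subgraph r s → Vertex r s → Vertex r s → ℕ
  isEdge G u v = ind (adj G u v)

  isNonEdge : Subgraph r s → Vertex r s → Vertex r s → ℕ
  isNonEdge G u v = nonEdgeInd (adj G u v) (samePart u v)

  -- Since G lies inside the host graph, every host edge is either an edge
  -- or a non-edge of G, and every other pair is neither.
  edge+nonEdge≡hostEdge : (G : Subgraph r s) → ∀ u v → isEdge G u v + isNonEdge G u v ≡ hostEdge u v
  edge+nonEdge≡hostEdge G u v with adj G u v in uv | part u ≟ part v
  ... | true  | yes same = ⊥-elim (inHost G u v uv same)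
  ... | true  | no  _    = refl
  ... | false | yes _    = refl
  ... | false | no  _    = refl

  noNonEdge⇒adjacent : (G : Subgraph r s) → ∀ u v → part u ≢ part v → isNonEdge G u v ≡ 0 → adj G u v ≡ true
  noNonEdge⇒adjacent G u v distinct none =
    nonEdgeInd≡0⇒adjacent (adj G u v)
      (subst (λ b → nonEdgeInd (adj G u v) b ≡ 0) (dec-false (part u ≟ part v) distinct) none)

  inPart : (i : Fin r) → Fin (s i) → Vertex r s
  inPart i a = (i , a)

  blockSum : (Vertex r s → Vertex r s → ℕ) → Fin r → Fin r → ℕ
  blockSum f i j = ∑ (allFin (s i)) (λ a → ∑ (allFin (s j)) (λ b → f (i , a) (j , b)))

  ∑pairs-vertices : (f : Vertex r s → Vertex r s → ℕ) → (∀ i a b → f (i , a) (i , b) ≡ 0) →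
    ∑pairs (vertices r s) f ≡ ∑pairs (allFin r) (blockSum f)
  ∑pairs-vertices f insideZero =
    trans (∑pairs-concatMap (λ i → map (inPart i) (allFin (s i))) (allFin r) f)
          (cong₂ _+_ (∑-zero (allFin r) insidePart) (∑pairs-cong (allFin r) betweenParts))
    where
    insidePart : ∀ i → ∑pairs (map (inPart i) (allFin (s i))) f ≡ 0
    insidePart i = trans (∑pairs-map (inPart i) (allFin (s i)) f)
                         (∑-zero (pairs (allFin (s i))) (λ p → insideZero i (proj₁ p) (proj₂ p)))
    betweenParts : ∀ i j → ∑ (map (inPart i) (allFin (s i))) (λ u → ∑ (map (inPart j) (allFin (s j))) (f u))
                            ≡ blockSum f i j
    betweenParts i j = trans (∑-map (inPart i) (allFin (s i)) _)
                             (∑-cong (allFin (s i)) (λ a → ∑-map (inPart j) (allFin (s j)) (f (i , a))))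

  blockSum-parts : (F : Fin r → Fin r → ℕ) →
    ∀ i j → blockSum (λ u v → F (part u) (part v)) i j ≡ s i * (s j * F i j)
  blockSum-parts F i j = trans (∑-cong (allFin (s i)) (λ _ → ∑-allFin-const (s j) (F i j)))
                               (∑-allFin-const (s i) _)

hostEdges : (r : ℕ) (s : Fin r → ℕ) → ℕ
hostEdges r s = ∑pairs (vertices r s) hostEdge

nonEdges : ∀ {r s} → Subgraph r s → ℕ
nonEdges {r} {s} G = ∑pairs (vertices r s) (isNonEdge G)

length-filter≡∑ind : ∀ (b : A → Bool) xs → length (filter (λ p → b p ≟ᵇ true) xs) ≡ ∑ xs (ind ∘ b)
length-filter≡∑ind b []       = refl
length-filter≡∑ind b (x ∷ xs) with b x
... | true  = cong suc (length-filter≡∑ind b xs)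
... | false = length-filter≡∑ind b xs

edgeCount≡hostEdges∸nonEdges : ∀ {r s} (G : Subgraph r s) → edgeCount G ≡ hostEdges r s ∸ nonEdges G
edgeCount≡hostEdges∸nonEdges {r} {s} G = begin
  edgeCount G
    ≡⟨ sym (m+n∸n≡m (edgeCount G) (nonEdges G)) ⟩
  edgeCount G + nonEdges G ∸ nonEdges G
    ≡⟨ cong (λ e → e + nonEdges G ∸ nonEdges G) edgeCount≡∑ ⟩
  ∑pairs V (isEdge G) + nonEdges G ∸ nonEdges G
    ≡⟨ cong (_∸ nonEdges G) (sym (∑-+ (pairs V) _ _)) ⟩
  ∑pairs V (λ u v → isEdge G u v + isNonEdge G u v) ∸ nonEdges G
    ≡⟨ cong (_∸ nonEdges G) (∑pairs-cong V (edge+nonEdge≡hostEdge G)) ⟩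
  hostEdges r s ∸ nonEdges G ∎
  where
  open ≡-Reasoning
  V : List (Vertex r s)
  V = vertices r s
  edgeCount≡∑ : edgeCount G ≡ ∑pairs V (isEdge G)
  edgeCount≡∑ = length-filter≡∑ind (λ p → adj G (proj₁ p) (proj₂ p)) (pairs V)

-- Lower bound: a K_r-free subgraph has many non-edges

module _ {r : ℕ} {s : Fin r → ℕ} (G : Subgraph r s) where

  -- Non-edges only join distinct parts, so they can be counted part by part.
  isNonEdge-samePart : ∀ i a b → isNonEdge G (i , a) (i , b) ≡ 0
  isNonEdge-samePart i a b =
    subst (λ same → nonEdgeInd (adj G (i , a) (i , b)) same ≡ 0) (sym (dec-true (i ≟ i) refl))
          (nonEdgeInd-samePart (adj G (i , a) (i , b)))

  nonEdges-byParts : nonEdges G ≡ ∑pairs (allFin r) (blockSum (isNonEdge G))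
  nonEdges-byParts = ∑pairs-vertices (isNonEdge G) isNonEdge-samePart

  nonEdgesOn : Transversal r s → ℕ
  nonEdgesOn t = ∑pairs (allFin r) (λ i j → isNonEdge G (i , t i) (j , t j))

  -- The vertices of a transversal lie in distinct parts, so if they span no
  -- non-edge they form a K_r.
  transversal-hasNonEdge : KFree r G → ∀ t → 1 ≤ nonEdgesOn t
  transversal-hasNonEdge kfree t = n≢0⇒n>0 (kfree ∘ clique)
    where
    clique : nonEdgesOn t ≡ 0 → ContainsK r G
    clique none = (λ i → (i , t i)) , cong proj₁ , adjacent
      where
      noNonEdge : ∀ {i j} → (i , j) ∈ pairs (allFin r) → isNonEdge G (i , t i) (j , t j) ≡ 0
      noNonEdge = ∑≡0⇒term≡0 (pairs (allFin r))
                    (λ p → isNonEdge G (proj₁ p , t (proj₁ p)) (proj₂ p , t (proj₂ p))) none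
      adjacent : ∀ i j → i ≢ j → adj G (i , t i) (j , t j) ≡ true
      adjacent i j i≢j with pairs-complete (allFin r) (∈-allFin i) (∈-allFin j) i≢j
      ... | inj₁ ij = noNonEdge⇒adjacent G _ _ i≢j (noNonEdge ij)
      ... | inj₂ ji = trans (symmetric G _ _) (noNonEdge⇒adjacent G _ _ (i≢j ∘ sym) (noNonEdge ji))

  onTransversals : Fin r → Fin r → ℕ
  onTransversals i j = ∑ (transversals r s) (λ t → isNonEdge G (i , t i) (j , t j))

  onTransversals-bound : ∀ c → (∀ i j → i ≢ j → c ≤ s i * s j) →
    ∀ i j → c * onTransversals i j ≤ #transversals r s * blockSum (isNonEdge G) i j
  onTransversals-bound c c≤ i j = byCases (i ≟ j)
    where
    byCases : Dec (i ≡ j) → c * onTransversals i j ≤ #transversals r s * blockSum (isNonEdge G) i j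
    byCases (yes refl) = ≤-trans (≤-reflexive (trans (cong (c *_) insideZero) (*-zeroʳ c))) z≤n
      where
      insideZero : onTransversals i i ≡ 0
      insideZero = ∑-zero (transversals r s) (λ t → isNonEdge-samePart i (t i) (t i))
    byCases (no i≢j) = begin
      c * onTransversals i j               ≤⟨ *-monoˡ-≤ (onTransversals i j) (c≤ i j i≢j) ⟩
      s i * s j * onTransversals i j       ≡⟨ *-comm (s i * s j) (onTransversals i j) ⟩
      onTransversals i j * (s i * s j)     ≡⟨ ∑T-coordinates r s i j i≢j (λ a b → isNonEdge G (i , a) (j , b)) ⟩
      #transversals r s * blockSum (isNonEdge G) i j ∎
      where open ≤-Reasoning

  nonEdges-lowerBound : KFree r G → (∀ i → 1 ≤ s i) →
    ∀ c → (∀ i j → i ≢ j → c ≤ s i * s j) → c ≤ nonEdges G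
  nonEdges-lowerBound kfree nonempty c c≤ = *-cancelʳ-≤ c (nonEdges G) N (begin
    c * N
      ≡⟨ cong (c *_) (sym (trans (∑T-const r s 1) (*-identityʳ N))) ⟩
    c * ∑ (transversals r s) (λ _ → 1)
      ≤⟨ *-monoʳ-≤ c (∑-mono (transversals r s) (transversal-hasNonEdge kfree)) ⟩
    c * ∑ (transversals r s) nonEdgesOn
      ≡⟨ cong (c *_) (∑-swap (transversals r s) (pairs (allFin r)) _) ⟩
    c * ∑pairs (allFin r) onTransversals
      ≡⟨ sym (∑-*ˡ (pairs (allFin r)) c _) ⟩
    ∑pairs (allFin r) (λ i j → c * onTransversals i j)
      ≤⟨ ∑-mono (pairs (allFin r)) (λ p → onTransversals-bound c c≤ (proj₁ p) (proj₂ p)) ⟩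
    ∑pairs (allFin r) (λ i j → N * blockSum (isNonEdge G) i j)
      ≡⟨ ∑-*ˡ (pairs (allFin r)) N _ ⟩
    N * ∑pairs (allFin r) (blockSum (isNonEdge G))
      ≡⟨ cong (N *_) (sym nonEdges-byParts) ⟩
    N * nonEdges G
      ≡⟨ *-comm N (nonEdges G) ⟩
    nonEdges G * N ∎)
    where
    open ≤-Reasoning
    N : ℕ
    N = #transversals r s
    instance
      N-nonZero : NonZero N
      N-nonZero = >-nonZero (#transversals-pos r s nonempty)

-- The construction: delete all edges between the first two parts

merge01 : ∀ {m} → Fin (suc (suc m)) → Fin (suc m)
merge01 zero    = zero
merge01 (suc i) = i

mergedAdj : ∀ {m} → Fin (suc (suc m)) → Fin (suc (suc m)) → Bool
mergedAdj i j = not (does (merge01 i ≟ merge01 j))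

does-sym : ∀ {n} (x y : Fin n) → does (x ≟ y) ≡ does (y ≟ x)
does-sym x y with x ≟ y
... | yes x≡y = sym (dec-true (y ≟ x) (sym x≡y))
... | no  x≢y = sym (dec-false (y ≟ x) (x≢y ∘ sym))

mergedAdj⇒distinct : ∀ {m} (i j : Fin (suc (suc m))) → mergedAdj i j ≡ true → merge01 i ≢ merge01 j
mergedAdj⇒distinct i j joined same = subst T (trans (sym joined) (cong not (dec-true (merge01 i ≟ merge01 j) same))) tt

nonEdgeInd-not : ∀ b → nonEdgeInd (not b) b ≡ 0
nonEdgeInd-not true  = refl
nonEdgeInd-not false = refl

module _ {m : ℕ} {s : Fin (suc (suc m)) → ℕ} where

  extremal : Subgraph (suc (suc m)) s
  extremal = record
    { adj       = λ u v → mergedAdj (part u) (part v)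
    ; symmetric = λ u v → cong not (does-sym (merge01 (part u)) (merge01 (part v)))
    ; inHost    = λ u v joined same → mergedAdj⇒distinct (part u) (part v) joined (cong merge01 same)
    }

  -- m + 2 vertices have, by pigeonhole, two whose parts merge to the same one.
  extremal-KFree : KFree (suc (suc m)) extremal
  extremal-KFree (f , _ , joined) with pigeonhole (n<1+n (suc m)) (merge01 ∘ part ∘ f)
  ... | i , j , i<j , same = mergedAdj⇒distinct (part (f i)) (part (f j)) (joined i j (<⇒≢ i<j)) same

  extremal-nonEdges : nonEdges extremal ≡ s zero * s (suc zero)
  extremal-nonEdges = begin
    nonEdges extremal
      ≡⟨ nonEdges-byParts extremal ⟩
    ∑pairs (allFin (suc (suc m))) (blockSum (isNonEdge extremal))
      ≡⟨ ∑pairs-cong (allFin (suc (suc m))) (blockSum-parts {s = s} F) ⟩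
    ∑pairs (allFin (suc (suc m))) (λ i j → s i * (s j * F i j))
      ≡⟨ ∑pairs-allFin-suc (suc m) _ ⟩
    ∑ (allFin (suc m)) (λ j → s zero * (s (suc j) * F zero (suc j)))
      + ∑pairs (allFin (suc m)) (λ i j → s (suc i) * (s (suc j) * F (suc i) (suc j)))
      ≡⟨ cong₂ _+_ fromPart0 amongOtherParts ⟩
    s zero * s (suc zero) + 0
      ≡⟨ +-identityʳ _ ⟩
    s zero * s (suc zero) ∎
    where
    open ≡-Reasoning
    F : Fin (suc (suc m)) → Fin (suc (suc m)) → ℕ
    F i j = nonEdgeInd (mergedAdj i j) (does (i ≟ j))
    vanish : ∀ a b → a * (b * 0) ≡ 0
    vanish a b = trans (cong (a *_) (*-zeroʳ b)) (*-zeroʳ a)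
    fromPart0 : ∑ (allFin (suc m)) (λ j → s zero * (s (suc j) * F zero (suc j))) ≡ s zero * s (suc zero)
    fromPart0 = begin
      ∑ (allFin (suc m)) (λ j → s zero * (s (suc j) * F zero (suc j)))
        ≡⟨ cong (λ L → ∑ L (λ j → s zero * (s (suc j) * F zero (suc j)))) (allFin-suc m) ⟩
      s zero * (s (suc zero) * 1) + ∑ (map suc (allFin m)) (λ j → s zero * (s (suc j) * F zero (suc j)))
        ≡⟨ cong₂ _+_ (cong (s zero *_) (*-identityʳ _))
                     (trans (∑-map suc (allFin m) _) (∑-zero (allFin m) (λ j → vanish (s zero) (s (suc (suc j)))))) ⟩
      s zero * s (suc zero) + 0
        ≡⟨ +-identityʳ _ ⟩
      s zero * s (suc zero) ∎
    amongOtherParts : ∑pairs (allFin (suc m)) (λ i j → s (suc i) * (s (suc j) * F (suc i) (suc j))) ≡ 0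
    amongOtherParts = ∑-zero (pairs (allFin (suc m))) λ p →
      trans (cong (λ x → s (suc (proj₁ p)) * (s (suc (proj₂ p)) * x)) (nonEdgeInd-not (does (proj₁ p ≟ proj₂ p))))
            (vanish (s (suc (proj₁ p))) (s (suc (proj₂ p))))

∑pairs-distinctParts : ∀ k c → ∑pairs (allFin k) (λ i j → c * ind (not (does (i ≟ j)))) ≡ (k C 2) * c
∑pairs-distinctParts zero    c = refl
∑pairs-distinctParts (suc k) c = begin
  ∑pairs (allFin (suc k)) (λ i j → c * ind (not (does (i ≟ j))))
    ≡⟨ ∑pairs-allFin-suc k _ ⟩
  ∑ (allFin k) (λ _ → c * 1) + ∑pairs (allFin k) (λ i j → c * ind (not (does (i ≟ j))))
    ≡⟨ cong₂ _+_ (trans (∑-allFin-const k (c * 1)) (cong (k *_) (*-identityʳ c))) (∑pairs-distinctParts k c) ⟩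
  k * c + (k C 2) * c
    ≡⟨ sym (*-distribʳ-+ c k (k C 2)) ⟩
  (k + k C 2) * c
    ≡⟨ cong (λ x → (x + k C 2) * c) (sym (nC1≡n k)) ⟩
  (k C 1 + k C 2) * c
    ≡⟨ cong (_* c) (nCk+nC[k+1]≡[n+1]C[k+1] k 1) ⟩
  (suc k C 2) * c ∎
  where open ≡-Reasoning

-- Part 0 meets each of the other m parts in n₁n₂ edges, and the m C 2
-- pairs of other parts contribute n₂² each.
hostEdges-sizes₁₂ : ∀ m n₁ n₂ → hostEdges (suc m) (sizes₁₂ n₁ n₂) ≡ m * n₁ * n₂ + (m C 2) * (n₂ * n₂)
hostEdges-sizes₁₂ m n₁ n₂ = begin
  hostEdges (suc m) s
    ≡⟨ ∑pairs-vertices {s = s} hostEdge (λ i _ _ → cong (ind ∘ not) (dec-true (i ≟ i) refl)) ⟩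
  ∑pairs (allFin (suc m)) (blockSum {s = s} hostEdge)
    ≡⟨ ∑pairs-cong (allFin (suc m)) (blockSum-parts {s = s} H) ⟩
  ∑pairs (allFin (suc m)) (λ i j → s i * (s j * H i j))
    ≡⟨ ∑pairs-allFin-suc m _ ⟩
  ∑ (allFin m) (λ _ → n₁ * (n₂ * 1)) + ∑pairs (allFin m) (λ i j → n₂ * (n₂ * H i j))
    ≡⟨ cong₂ _+_ (∑-allFin-const m _)
                 (trans (∑pairs-cong (allFin m) (λ i j → sym (*-assoc n₂ n₂ (H i j))))
                        (∑pairs-distinctParts m (n₂ * n₂))) ⟩
  m * (n₁ * (n₂ * 1)) + (m C 2) * (n₂ * n₂)
    ≡⟨ cong (_+ (m C 2) * (n₂ * n₂)) (reassociate m n₁ n₂) ⟩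
  m * n₁ * n₂ + (m C 2) * (n₂ * n₂) ∎
  where
  open ≡-Reasoning
  s : Fin (suc m) → ℕ
  s = sizes₁₂ n₁ n₂
  H : ∀ {k} → Fin k → Fin k → ℕ
  H i j = ind (not (does (i ≟ j)))
  reassociate : ∀ a b c → a * (b * (c * 1)) ≡ a * b * c
  reassociate = solve-∀

lemma2 : ∀ (r n₁ n₂ : ℕ) → 3 ≤ r → 1 ≤ n₁ → n₁ ≤ n₂ →
    ExIs r (sizes₁₂ n₁ n₂) r
    (((r ∸ 1) * n₁ * n₂ + ((r ∸ 1) C 2) * (n₂ * n₂)) ∸ n₁ * n₂)
lemma2 r@(suc (suc (suc k))) n₁ n₂ (s≤s (s≤s (s≤s z≤n))) 1≤n₁ n₁≤n₂ =
  (extremal , extremal-KFree , attained) , upperBound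
  where
  s : Fin r → ℕ
  s = sizes₁₂ n₁ n₂
  host : ℕ
  host = suc (suc k) * n₁ * n₂ + (suc (suc k) C 2) * (n₂ * n₂)
  edges : ∀ (G : Subgraph r s) → edgeCount G ≡ host ∸ nonEdges G
  edges G = trans (edgeCount≡hostEdges∸nonEdges G)
                  (cong (_∸ nonEdges G) (hostEdges-sizes₁₂ (suc (suc k)) n₁ n₂))
  attained : edgeCount (extremal {s = s}) ≡ host ∸ n₁ * n₂
  attained = trans (edges extremal) (cong (host ∸_) (extremal-nonEdges {s = s}))
  nonempty : ∀ i → 1 ≤ s i
  nonempty zero    = 1≤n₁
  nonempty (suc _) = ≤-trans 1≤n₁ n₁≤n₂
  -- n₁ and n₂ are the two smallest part sizes
  n₁n₂≤ : ∀ i j → i ≢ j → n₁ * n₂ ≤ s i * s j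
  n₁n₂≤ zero    zero    i≢j = ⊥-elim (i≢j refl)
  n₁n₂≤ zero    (suc _) _   = ≤-refl
  n₁n₂≤ (suc _) zero    _   = ≤-reflexive (*-comm n₁ n₂)
  n₁n₂≤ (suc _) (suc _) _   = *-monoˡ-≤ n₂ n₁≤n₂
  upperBound : ∀ G → KFree r G → edgeCount G ≤ host ∸ n₁ * n₂
  upperBound G kfree = subst (_≤ host ∸ n₁ * n₂) (sym (edges G))
                             (∸-monoʳ-≤ host (nonEdges-lowerBound G kfree nonempty (n₁ * n₂) n₁n₂≤))
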